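{- For all sequences of bins $\sigma$ and all integers $s',\ell'\ge 0$, if $2k\ge s'+2\ell'$, then $$R(\sigma,0,k)\le \mathrm{OPT}(\sigma,s',\ell')+\min\{0,\ell'-s'\}\,S+(k-\ell')M.$$
   Context: Restricted Grid Scheduling setting: $S>1$ is an integer, $L=2S-1$, $M=4S-3$; bins have integer sizes in $[S,M]$ and $\sigma$ contains enough bins for all items to be packed. A packing is valid if each empty bin is smaller than every item packed in a later bin; its cost is the sum of sizes of bins receiving at least one item. $\mathrm{OPT}(\sigma,s,\ell)$ is the minimum cost of a valid packing of $s$ items of size $S$ and $\ell$ items of size $L$ into $\sigma$. A bin is wasteful if its empty space is at least as large as some item packed in a later bin; a packing is thrifty if no bin is wasteful. A partial packing is reasonable if every bin $b$ it packs contains: one item of size $S$ if $\mathrm{size}(b)\in[S,L-1]$; one item of size $L$ if $\mathrm{size}(b)=L$; two items of size $S$ or one of size $L$ if $\mathrm{size}(b)\in[L+1,L+S-1]$; one item of size $S$ and one of size $L$ if $\mathrm{size}(b)=L+S$; three items of size $S$ or one of size $S$ and one of size $L$ if $\mathrm{size}(b)\in[L+S+1,2L-1]$. The key bin of a packing is the first bin after which no items of size $L$ remain or at most two items of size $S$ remain; the front is the partial packing agreeing with the packing up to and including the key bin and empty afterwards. A packing is reasonable if it is thrifty and its front is reasonable. $R(\sigma,s,\ell)$ is the maximum cost of any reasonable packing of $s$ items of size $S$ and $\ell$ items of size $L$ into $\sigma$. -}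

module Defs where

open import Data.Nat using (ℕ; zero; suc; _+_; _*_; _∸_; _≤_; _<_)
open import Data.Nat.Base using (_<ᵇ_)
open import Data.Bool using (if_then_else_)
open import Data.Fin using (Fin; toℕ) renaming (zero to fzero; suc to fsuc)
open import Data.Vec using (Vec; lookup)
open import Data.Product using (_×_; _,_; proj₁; proj₂; ∃)
open import Data.Sum using (_⊎_)
open import Relation.Nullary using (¬_)
open import Relation.Binary.PropositionalEquality using (_≡_)

-- Item sizes: small items have size S, large items have size L = 2S-1;
-- the maximum bin size is M = 4S-3.
L : ℕ → ℕ
L S = 2 * S ∸ 1

M : ℕ → ℕ
M S = 4 * S ∸ 3

-- A sequence of n bins is given by the vector of their sizes.
-- All bin sizes lie in [S, M].
BinSizesOK : (S : ℕ) {n : ℕ} → Vec ℕ n → Set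
BinSizesOK S σ = ∀ i → S ≤ lookup σ i × lookup σ i ≤ M S

-- Items of equal size are indistinguishable, so a packing into n bins is
-- described by, for each bin, the pair
-- (number of items of size S, number of items of size L) packed in it.
Packing : ℕ → Set
Packing n = Vec (ℕ × ℕ) n

nS : ∀ {n} → Packing n → Fin n → ℕ
nS p i = proj₁ (lookup p i)

nL : ∀ {n} → Packing n → Fin n → ℕ
nL p i = proj₂ (lookup p i)

sumFin : ∀ {n} → (Fin n → ℕ) → ℕ
sumFin {zero} f = 0
sumFin {suc n} f = f fzero + sumFin (λ j → f (fsuc j))

load : (S : ℕ) {n : ℕ} → Packing n → Fin n → ℕ
load S p i = nS p i * S + nL p i * L S

Packs : (S : ℕ) {n : ℕ} → Vec ℕ n → ℕ → ℕ → Packing n → Set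
Packs S σ s ℓ p =
  (∀ i → load S p i ≤ lookup σ i) ×
  sumFin (nS p) ≡ s × sumFin (nL p) ≡ ℓ

EmptyBin : ∀ {n} → Packing n → Fin n → Set
EmptyBin p i = nS p i ≡ 0 × nL p i ≡ 0

_≺_ : ∀ {n} → Fin n → Fin n → Set
i ≺ j = toℕ i < toℕ j

Valid : (S : ℕ) {n : ℕ} → Vec ℕ n → Packing n → Set
Valid S σ p = ∀ i j → i ≺ j → EmptyBin p i →
  (0 < nS p j → lookup σ i < S) × (0 < nL p j → lookup σ i < L S)

Wasteful : (S : ℕ) {n : ℕ} → Vec ℕ n → Packing n → Fin n → Set
Wasteful S σ p i = ∃ λ j → i ≺ j ×
  ((0 < nS p j × S ≤ lookup σ i ∸ load S p i) ⊎
   (0 < nL p j × L S ≤ lookup σ i ∸ load S p i))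

Thrifty : (S : ℕ) {n : ℕ} → Vec ℕ n → Packing n → Set
Thrifty S σ p = ∀ i → ¬ Wasteful S σ p i

binCost : ℕ → ℕ × ℕ → ℕ
binCost b (zero , zero) = 0
binCost b (_ , _) = b

cost : ∀ {n} → Vec ℕ n → Packing n → ℕ
cost σ p = sumFin (λ i → binCost (lookup σ i) (lookup p i))

remS : ∀ {n} → Packing n → Fin n → ℕ
remS p i = sumFin (λ j → if toℕ i <ᵇ toℕ j then nS p j else 0)

remL : ∀ {n} → Packing n → Fin n → ℕ
remL p i = sumFin (λ j → if toℕ i <ᵇ toℕ j then nL p j else 0)

KeyCond : ∀ {n} → Packing n → Fin n → Set
KeyCond p i = remL p i ≡ 0 ⊎ remS p i ≤ 2

IsKeyBin : ∀ {n} → Packing n → Fin n → Set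
IsKeyBin p i = KeyCond p i × (∀ j → j ≺ i → ¬ KeyCond p j)

ReasonableBin : (S : ℕ) → ℕ → ℕ × ℕ → Set
ReasonableBin S b c =
  (S ≤ b → b ≤ L S ∸ 1 → c ≡ (1 , 0)) ×
  (b ≡ L S → c ≡ (0 , 1)) ×
  (L S + 1 ≤ b → b ≤ L S + S ∸ 1 → c ≡ (2 , 0) ⊎ c ≡ (0 , 1)) ×
  (b ≡ L S + S → c ≡ (1 , 1)) ×
  (L S + S + 1 ≤ b → b ≤ 2 * L S ∸ 1 → c ≡ (3 , 0) ⊎ c ≡ (1 , 1))

-- the front (agreeing with p up to and including the key bin, empty
-- afterwards) is reasonable: every bin it packs, i.e. every nonempty bin
-- up to and including the key bin, has reasonable contents.
FrontReasonable : (S : ℕ) {n : ℕ} → Vec ℕ n → Packing n → Set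
FrontReasonable S σ p = ∀ k → IsKeyBin p k → ∀ j → toℕ j Data.Nat.≤ toℕ k →
  ¬ EmptyBin p j → ReasonableBin S (lookup σ j) (lookup p j)

ReasonablePacking : (S : ℕ) {n : ℕ} → Vec ℕ n → ℕ → ℕ → Packing n → Set
ReasonablePacking S σ s ℓ p =
  Packs S σ s ℓ p × Thrifty S σ p × FrontReasonable S σ p

ValidPacking : (S : ℕ) {n : ℕ} → Vec ℕ n → ℕ → ℕ → Packing n → Set
ValidPacking S σ s ℓ p = Packs S σ s ℓ p × Valid S σ p

-- A bin holds at most one item of size L, since 2L > M. If some bin i is used
-- by Q but empty in P, validity of P leaves every bin after i empty in P, and
-- thriftiness of Q makes Q use every bin of size at least L before i; the
-- bound then holds bin by bin. Otherwise every bin used by Q is used by P, so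
-- cost Q ≤ cost P, and s′S + ℓ′M ≤ kM follows from 2S ≤ M.
module Submission where

open import Defs
open import Data.Nat using (ℕ; zero; suc; >-nonZero; _+_; _*_; _∸_; _≤_; _<_; z≤n; s≤s; z<s; _≤?_; _<?_; _≟_)
open import Data.Nat.Properties
open import Data.Nat.Tactic.RingSolver using (solve-∀)
open import Data.Integer using (ℤ; +_; -_; _-_; _⊓_; +≤+) renaming (_+_ to _+ℤ_; _*_ to _*ℤ_; _≤_ to _≤ℤ_)
import Data.Integer.Properties as ℤ
import Data.Integer.Tactic.RingSolver as ℤ-Solver
open import Data.Fin using (Fin; toℕ) renaming (zero to fzero; suc to fsuc)
open import Data.Fin.Properties using (any?; toℕ-injective)
open import Data.Vec using (Vec; lookup)
open import Data.Product using (_×_; _,_; proj₁; proj₂; ∃)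
open import Data.Sum using (_⊎_; inj₁; inj₂)
open import Data.Empty using (⊥; ⊥-elim)
open import Relation.Nullary using (¬_; Dec; yes; no)
open import Relation.Nullary.Decidable using (_×-dec_)
open import Relation.Binary using (tri<; tri≈; tri>)
open import Relation.Binary.PropositionalEquality

L-2+ : ∀ t → L (2 + t) ≡ 3 + 2 * t
L-2+ t = cong (_∸ 1) (*-distribˡ-+ 2 2 t)

M-2+ : ∀ t → M (2 + t) ≡ 5 + 4 * t
M-2+ t = cong (_∸ 3) (*-distribˡ-+ 4 2 t)

M<L+L : ∀ {S} → 2 ≤ S → M S < L S + L S
M<L+L {suc (suc t)} (s≤s (s≤s _)) = begin-strict
  M (2 + t)                 ≡⟨ M-2+ t ⟩
  5 + 4 * t                 <⟨ n<1+n _ ⟩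
  6 + 4 * t                 ≡⟨ e t ⟩
  (3 + 2 * t) + (3 + 2 * t) ≡⟨ sym (cong₂ _+_ (L-2+ t) (L-2+ t)) ⟩
  L (2 + t) + L (2 + t)     ∎
  where
  open ≤-Reasoning
  e : ∀ t → 6 + 4 * t ≡ (3 + 2 * t) + (3 + 2 * t)
  e = solve-∀

M<S+S+L : ∀ {S} → 2 ≤ S → M S < S + S + L S
M<S+S+L {suc (suc t)} (s≤s (s≤s _)) = begin-strict
  M (2 + t)                         ≡⟨ M-2+ t ⟩
  5 + 4 * t                         <⟨ m<n+m _ {2} z<s ⟩
  7 + 4 * t                         ≡⟨ e t ⟩
  (2 + t) + (2 + t) + (3 + 2 * t)   ≡⟨ sym (cong (_+_ (2 + t + (2 + t))) (L-2+ t)) ⟩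
  (2 + t) + (2 + t) + L (2 + t)     ∎
  where
  open ≤-Reasoning
  e : ∀ t → 7 + 4 * t ≡ (2 + t) + (2 + t) + (3 + 2 * t)
  e = solve-∀

L<S+S : ∀ {S} → 2 ≤ S → L S < S + S
L<S+S {suc (suc t)} (s≤s (s≤s _)) = begin-strict
  L (2 + t)          ≡⟨ L-2+ t ⟩
  3 + 2 * t          <⟨ n<1+n _ ⟩
  4 + 2 * t          ≡⟨ e t ⟩
  (2 + t) + (2 + t)  ∎
  where
  open ≤-Reasoning
  e : ∀ t → 4 + 2 * t ≡ (2 + t) + (2 + t)
  e = solve-∀

S+S≤M : ∀ {S} → 2 ≤ S → S + S ≤ M S
S+S≤M {suc (suc t)} (s≤s (s≤s _)) = begin
  (2 + t) + (2 + t)  ≡⟨ e t ⟩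
  4 + 2 * t          <⟨ n<1+n _ ⟩
  5 + 2 * t          ≤⟨ +-monoʳ-≤ 5 (*-monoˡ-≤ t {2} {4} (s≤s (s≤s z≤n))) ⟩
  5 + 4 * t          ≡⟨ sym (M-2+ t) ⟩
  M (2 + t)          ∎
  where
  open ≤-Reasoning
  e : ∀ t → (2 + t) + (2 + t) ≡ 4 + 2 * t
  e = solve-∀

x+x≤2+r*x : ∀ r x → x + x ≤ suc (suc r) * x
x+x≤2+r*x r x = +-monoʳ-≤ x (m≤m+n x (r * x))

sumFin-mono-≤ : ∀ {n} {f g : Fin n → ℕ} → (∀ i → f i ≤ g i) → sumFin f ≤ sumFin g
sumFin-mono-≤ {zero} _ = z≤n
sumFin-mono-≤ {suc n} f≤g = +-mono-≤ (f≤g fzero) (sumFin-mono-≤ (λ i → f≤g (fsuc i)))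

sumFin-+-* : ∀ {n} (f g : Fin n → ℕ) c → sumFin (λ i → f i + g i * c) ≡ sumFin f + sumFin g * c
sumFin-+-* {zero} f g c = refl
sumFin-+-* {suc n} f g c = begin
  f fzero + g fzero * c + sumFin (λ i → f (fsuc i) + g (fsuc i) * c)
    ≡⟨ cong (_+_ (f fzero + g fzero * c)) (sumFin-+-* (λ i → f (fsuc i)) (λ i → g (fsuc i)) c) ⟩
  f fzero + g fzero * c + (sumFin (λ i → f (fsuc i)) + sumFin (λ i → g (fsuc i)) * c)
    ≡⟨ e (f fzero) (g fzero) (sumFin (λ i → f (fsuc i))) (sumFin (λ i → g (fsuc i))) c ⟩
  sumFin f + sumFin g * c ∎
  where
  open ≡-Reasoning
  e : ∀ x y z w c → x + y * c + (z + w * c) ≡ x + z + (y + w) * c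
  e = solve-∀

sumFin≡0⇒≡0 : ∀ {n} (f : Fin n → ℕ) → sumFin f ≡ 0 → ∀ i → f i ≡ 0
sumFin≡0⇒≡0 f sum≡0 fzero = m+n≡0⇒m≡0 (f fzero) sum≡0
sumFin≡0⇒≡0 f sum≡0 (fsuc i) = sumFin≡0⇒≡0 (λ j → f (fsuc j)) (m+n≡0⇒n≡0 (f fzero) sum≡0) i

-- Subtraction-free forms of  cQ ≤ cP + (b − a) S + (q − b) M  and  cQ ≤ cP + (q − b) M,
-- the two cases of the theorem's bound.
record Exchange (S M cQ cP q a b : ℕ) : Set where
  constructor mkExchange
  field
    withSmall    : cQ + a * S + b * M ≤ cP + q * M + b * S
    withoutSmall : cQ + b * M ≤ cP + q * M

sumFin-Exchange : ∀ {S M n} {cQ cP q a b : Fin n → ℕ} →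
  (∀ i → Exchange S M (cQ i) (cP i) (q i) (a i) (b i)) →
  Exchange S M (sumFin cQ) (sumFin cP) (sumFin q) (sumFin a) (sumFin b)
sumFin-Exchange {S} {M} {cQ = cQ} {cP} {q} {a} {b} ex = mkExchange
  (subst₂ _≤_ (sum₂ cQ a S b M) (sum₂ cP q M b S)
    (sumFin-mono-≤ (λ i → Exchange.withSmall (ex i))))
  (subst₂ _≤_ (sumFin-+-* cQ b M) (sumFin-+-* cP q M)
    (sumFin-mono-≤ (λ i → Exchange.withoutSmall (ex i))))
  where
  sum₂ : ∀ f g c h d → sumFin (λ i → f i + g i * c + h i * d) ≡ sumFin f + sumFin g * c + sumFin h * d
  sum₂ f g c h d = trans (sumFin-+-* (λ i → f i + g i * c) h d) (cong (_+ sumFin h * d) (sumFin-+-* f g c))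

m*S+n*M≤k*M : ∀ {S M} m n k → S + S ≤ M → m + 2 * n ≤ 2 * k → m * S + n * M ≤ k * M
m*S+n*M≤k*M {S} {M} m n k S+S≤M hk = *-cancelˡ-≤ 2 (begin
  2 * (m * S + n * M)    ≡⟨ e₁ m S n M ⟩
  m * (S + S) + 2 * n * M ≤⟨ +-monoˡ-≤ (2 * n * M) (*-monoʳ-≤ m S+S≤M) ⟩
  m * M + 2 * n * M      ≡⟨ e₂ m n M ⟩
  (m + 2 * n) * M        ≤⟨ *-monoˡ-≤ M hk ⟩
  2 * k * M              ≡⟨ *-assoc 2 k M ⟩
  2 * (k * M)            ∎)
  where
  open ≤-Reasoning
  e₁ : ∀ m S n M → 2 * (m * S + n * M) ≡ m * (S + S) + 2 * n * M
  e₁ = solve-∀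
  e₂ : ∀ m n M → m * M + 2 * n * M ≡ (m + 2 * n) * M
  e₂ = solve-∀

Exchange-of-≤ : ∀ {S M cQ cP k s ℓ} → S + S ≤ M → s + 2 * ℓ ≤ 2 * k → cQ ≤ cP →
  Exchange S M cQ cP k s ℓ
Exchange-of-≤ {S} {M} {cQ} {cP} {k} {s} {ℓ} S+S≤M hk cQ≤cP = mkExchange
  (≤-trans (≤-reflexive (+-assoc cQ (s * S) (ℓ * M)))
    (≤-trans (+-mono-≤ cQ≤cP (m*S+n*M≤k*M s ℓ k S+S≤M hk)) (m≤m+n _ _)))
  (+-mono-≤ cQ≤cP (*-monoˡ-≤ M ℓ≤k))
  where
  ℓ≤k : ℓ ≤ k
  ℓ≤k = *-cancelˡ-≤ 2 (≤-trans (m≤n+m (2 * ℓ) s) hk)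

pos-+-* : ∀ a b c → + (a + b * c) ≡ + a +ℤ + b *ℤ + c
pos-+-* a b c = trans (ℤ.pos-+ a (b * c)) (cong (_+ℤ_ (+ a)) (ℤ.pos-* b c))

pos-+-*-+-* : ∀ a b c d e → + (a + b * c + d * e) ≡ + a +ℤ + b *ℤ + c +ℤ + d *ℤ + e
pos-+-*-+-* a b c d e = trans (pos-+-* (a + b * c) d e) (cong (_+ℤ + d *ℤ + e) (pos-+-* a b c))

≤-cancel-shift : ∀ {a b} (c : ℤ) {x y} → + a ≡ x +ℤ c → + b ≡ y +ℤ c → a ≤ b → x ≤ℤ y
≤-cancel-shift c {x} {y} a≡x+c b≡y+c a≤b = subst₂ _≤ℤ_ (cancel x c) (cancel y c)
  (ℤ.+-monoˡ-≤ (- c) (subst₂ _≤ℤ_ a≡x+c b≡y+c (+≤+ a≤b)))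
  where
  cancel : ∀ z c → z +ℤ c +ℤ - c ≡ z
  cancel = ℤ-Solver.solve-∀

Exchange⇒bound : ∀ {S M cQ cP k s ℓ} → Exchange S M cQ cP k s ℓ →
  + cQ ≤ℤ + cP +ℤ ((+ 0) ⊓ (+ ℓ - + s)) *ℤ + S +ℤ (+ k - + ℓ) *ℤ + M
Exchange⇒bound {S} {M} {cQ} {cP} {k} {s} {ℓ} (mkExchange withSmall withoutSmall) with s ≤? ℓ
... | yes s≤ℓ rewrite ℤ.i≤j⇒i⊓j≡i (ℤ.i≤j⇒0≤j-i (+≤+ s≤ℓ)) =
  ≤-cancel-shift (+ ℓ *ℤ + M) (pos-+-* cQ ℓ M)
    (trans (pos-+-* cP k M) (e (+ cP) (+ S) (+ k) (+ ℓ) (+ M))) withoutSmall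
  where
  e : ∀ cP S k ℓ M → cP +ℤ k *ℤ M ≡ cP +ℤ (+ 0) *ℤ S +ℤ (k - ℓ) *ℤ M +ℤ ℓ *ℤ M
  e = ℤ-Solver.solve-∀
... | no s≰ℓ rewrite ℤ.i≥j⇒i⊓j≡j (ℤ.i≤j⇒i-j≤0 (+≤+ (<⇒≤ (≰⇒> s≰ℓ)))) =
  ≤-cancel-shift (+ s *ℤ + S +ℤ + ℓ *ℤ + M)
    (trans (pos-+-*-+-* cQ s S ℓ M) (ℤ.+-assoc (+ cQ) (+ s *ℤ + S) (+ ℓ *ℤ + M)))
    (trans (pos-+-*-+-* cP k M ℓ S) (e (+ cP) (+ S) (+ k) (+ ℓ) (+ M) (+ s))) withSmall
  where
  e : ∀ cP S k ℓ M s →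
      cP +ℤ k *ℤ M +ℤ ℓ *ℤ S ≡ cP +ℤ (ℓ - s) *ℤ S +ℤ (k - ℓ) *ℤ M +ℤ (s *ℤ S +ℤ ℓ *ℤ M)
  e = ℤ-Solver.solve-∀

at-most-one-L : ∀ {S σ} → 2 ≤ S → ∀ r → suc (suc r) * L S ≤ σ → σ ≤ M S → ⊥
at-most-one-L {S} S≥2 r fit σ≤M = <⇒≱ (M<L+L S≥2) (≤-trans (x+x≤2+r*x r (L S)) (≤-trans fit σ≤M))

binExchange : ∀ {S σ q a b} → 2 ≤ S → S ≤ σ → σ ≤ M S → q * L S ≤ σ → a * S + b * L S ≤ σ →
  (a ≡ 0 × b ≡ 0) ⊎ (q ≡ 0 → σ < L S) →
  Exchange S (M S) (binCost σ (0 , q)) (binCost σ (a , b)) q a b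
binExchange {q = suc (suc r)} S≥2 _ σ≤M fitQ _ _ = ⊥-elim (at-most-one-L S≥2 r fitQ σ≤M)
binExchange {S} {a = a} {b = suc (suc r)} S≥2 _ σ≤M _ fitP _ =
  ⊥-elim (at-most-one-L S≥2 r (≤-trans (m≤n+m _ (a * S)) fitP) σ≤M)
binExchange {q = 0} {a = 0} {b = 0} _ _ _ _ _ _ = mkExchange z≤n z≤n
binExchange {q = 0} {b = 1} _ _ _ _ _ (inj₁ (_ , ()))
binExchange {S} {q = 0} {a} {b = 1} _ _ _ _ fitP (inj₂ σ<L) =
  ⊥-elim (<⇒≱ (σ<L refl) (≤-trans (m≤m+n (L S) 0) (≤-trans (m≤n+m _ (a * S)) fitP)))
binExchange {q = 0} {a = suc _} {b = 0} _ _ _ _ _ (inj₁ (() , _))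
binExchange {q = 0} {a = 1} {b = 0} _ S≤σ _ _ _ _ = mkExchange (+-monoˡ-≤ 0 (+-monoˡ-≤ 0 S≤σ)) z≤n
binExchange {S} {q = 0} {a = suc (suc r)} {b = 0} S≥2 _ _ _ fitP (inj₂ σ<L) =
  ⊥-elim (<⇒≱ (<-trans (σ<L refl) (L<S+S S≥2)) (≤-trans (x+x≤2+r*x r S) (≤-trans (m≤m+n _ 0) fitP)))
binExchange {q = 1} {a = 0} {b = 0} _ _ σ≤M _ _ _ =
  mkExchange (+-monoˡ-≤ 0 (+-monoˡ-≤ 0 σ≤M)) (+-monoˡ-≤ 0 σ≤M)
binExchange {S} {σ} {q = 1} {a = suc a} {b = 0} _ _ σ≤M _ fitP _ = mkExchange
  (+-monoˡ-≤ 0 (+-monoʳ-≤ σ (≤-trans (m≤m+n _ 0) (≤-trans fitP (≤-trans σ≤M (m≤m+n _ 0))))))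
  (+-monoʳ-≤ σ z≤n)
binExchange {σ = σ} {q = 1} {a = 0} {b = 1} _ _ _ _ _ _ =
  mkExchange (≤-trans (≤-reflexive (cong (_+ _) (+-identityʳ σ))) (m≤m+n _ _)) ≤-refl
binExchange {S} {σ} {q = 1} {a = 1} {b = 1} _ _ _ _ _ _ =
  mkExchange (≤-reflexive (+-comm-tail σ (S + 0) (M S + 0))) ≤-refl
  where
  +-comm-tail : ∀ x y z → x + y + z ≡ x + z + y
  +-comm-tail = solve-∀
binExchange {S} {q = 1} {a = suc (suc r)} {b = 1} S≥2 _ σ≤M _ fitP _ =
  ⊥-elim (<⇒≱ (M<S+S+L S≥2) (≤-trans (+-mono-≤ (x+x≤2+r*x r S) (m≤m+n (L S) 0)) (≤-trans fitP σ≤M)))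

binCost-≤ : ∀ {σ q a b} → (0 < q → ¬ (a ≡ 0 × b ≡ 0)) → binCost σ (0 , q) ≤ binCost σ (a , b)
binCost-≤ {q = 0} _ = z≤n
binCost-≤ {q = suc _} {a = suc _} _ = ≤-refl
binCost-≤ {q = suc _} {a = 0} {b = suc _} _ = ≤-refl
binCost-≤ {q = suc _} {a = 0} {b = 0} used = ⊥-elim (used z<s (refl , refl))

emptyBin? : ∀ {n} (p : Packing n) i → Dec (EmptyBin p i)
emptyBin? p i = (nS p i ≟ 0) ×-dec (nL p i ≟ 0)

valid-emptyAfter : ∀ {S n} {σ : Vec ℕ n} {p : Packing n} {i j} → Valid S σ p → EmptyBin p i →
  S ≤ lookup σ i → L S ≤ lookup σ i → i ≺ j → EmptyBin p j
valid-emptyAfter {i = i} {j} valid emptyᵢ S≤σᵢ L≤σᵢ i≺j =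
  noItem (proj₁ (valid i j i≺j emptyᵢ)) S≤σᵢ , noItem (proj₂ (valid i j i≺j emptyᵢ)) L≤σᵢ
  where
  noItem : ∀ {x c d} → (0 < x → c < d) → d ≤ c → x ≡ 0
  noItem item⇒c<d d≤c = n≤0⇒n≡0 (≮⇒≥ (λ 0<x → <⇒≱ (item⇒c<d 0<x) d≤c))

thrifty-emptyBin<L : ∀ {S n} {σ : Vec ℕ n} {p : Packing n} {i j} → Thrifty S σ p →
  i ≺ j → 0 < nL p j → load S p i ≡ 0 → lookup σ i < L S
thrifty-emptyBin<L {S} {σ = σ} {i = i} {j} thrifty i≺j largeⱼ load≡0 = ≰⇒> λ L≤σᵢ →
  thrifty i (j , i≺j , inj₂ (largeⱼ , subst (λ x → L S ≤ lookup σ i ∸ x) (sym load≡0) L≤σᵢ))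

module OnlyLargeItems {S : ℕ} (S≥2 : 2 ≤ S) {n : ℕ} (σ : Vec ℕ n) (sizes : BinSizesOK S σ)
  (Q : Packing n) (fitQ : ∀ j → load S Q j ≤ lookup σ j) (noSmall : ∀ j → nS Q j ≡ 0) where

  binCost-Q : ∀ j → binCost (lookup σ j) (0 , nL Q j) ≡ binCost (lookup σ j) (lookup Q j)
  binCost-Q j = cong (λ x → binCost (lookup σ j) (x , nL Q j)) (sym (noSmall j))

  fitL : ∀ j → nL Q j * L S ≤ lookup σ j
  fitL j = subst (λ x → x * S + nL Q j * L S ≤ lookup σ j) (noSmall j) (fitQ j)

  exchange-emptied : ∀ P → Thrifty S σ Q → (∀ j → load S P j ≤ lookup σ j) →
    Valid S σ P → ∀ {i} → 0 < nL Q i → EmptyBin P i →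
    Exchange S (M S) (cost σ Q) (cost σ P) (sumFin (nL Q)) (sumFin (nS P)) (sumFin (nL P))
  exchange-emptied P thrifty fitP valid {i} usedᵢ emptyᵢ = sumFin-Exchange λ j →
    subst (λ c → Exchange S (M S) c _ _ _ _) (binCost-Q j)
      (binExchange S≥2 (proj₁ (sizes j)) (proj₂ (sizes j)) (fitL j) (fitP j) (emptyOrUsed j))
    where
    L≤σᵢ : L S ≤ lookup σ i
    L≤σᵢ = ≤-trans (m≤n*m (L S) (nL Q i) {{>-nonZero usedᵢ}}) (fitL i)
    emptyOrUsed : ∀ j → EmptyBin P j ⊎ (nL Q j ≡ 0 → lookup σ j < L S)
    emptyOrUsed j with <-cmp (toℕ j) (toℕ i)
    ... | tri< j≺i _ _ = inj₂ λ unusedⱼ → thrifty-emptyBin<L {σ = σ} {Q} thrifty j≺i usedᵢ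
            (cong₂ (λ x y → x * S + y * L S) (noSmall j) unusedⱼ)
    ... | tri≈ _ j≡i _ = inj₁ (subst (EmptyBin P) (sym (toℕ-injective j≡i)) emptyᵢ)
    ... | tri> _ _ i≺j = inj₁ (valid-emptyAfter {σ = σ} {P} valid emptyᵢ (proj₁ (sizes i)) L≤σᵢ i≺j)

  exchange-notEmptied : ∀ P {s ℓ} → s + 2 * ℓ ≤ 2 * sumFin (nL Q) →
    (∀ i → 0 < nL Q i → ¬ EmptyBin P i) → Exchange S (M S) (cost σ Q) (cost σ P) (sumFin (nL Q)) s ℓ
  exchange-notEmptied P hk notEmptied = Exchange-of-≤ (S+S≤M S≥2) hk (sumFin-mono-≤ λ j →
    subst (_≤ _) (binCost-Q j) (binCost-≤ (notEmptied j)))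

lemma8 : (S : ℕ) → 2 ≤ S → {n : ℕ} → (σ : Vec ℕ n) → BinSizesOK S σ →
    (k s′ ℓ′ : ℕ) → s′ + 2 * ℓ′ ≤ 2 * k →
    (Q P : Packing n) → ReasonablePacking S σ 0 k Q → ValidPacking S σ s′ ℓ′ P →
    + cost σ Q ≤ℤ + cost σ P +ℤ ((+ 0) ⊓ (+ ℓ′ - + s′)) *ℤ + S +ℤ (+ k - + ℓ′) *ℤ + M S
lemma8 S S≥2 σ sizes _ _ _ hk Q P
       ((fitQ , noSmallQ , refl) , thriftyQ , _) ((fitP , refl , refl) , validP) =
  Exchange⇒bound (exchange (any? λ i → (0 <? nL Q i) ×-dec emptyBin? P i))
  where
  open OnlyLargeItems S≥2 σ sizes Q fitQ (sumFin≡0⇒≡0 (nS Q) noSmallQ)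
  exchange : Dec (∃ λ i → 0 < nL Q i × EmptyBin P i) →
    Exchange S (M S) (cost σ Q) (cost σ P) (sumFin (nL Q)) (sumFin (nS P)) (sumFin (nL P))
  exchange (yes (_ , usedᵢ , emptyᵢ)) = exchange-emptied P thriftyQ fitP validP usedᵢ emptyᵢ
  exchange (no none) = exchange-notEmptied P hk λ i usedᵢ emptyᵢ → none (i , usedᵢ , emptyᵢ)
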